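{- Let $G^1$ be a 1-graph. Any two 1-nodes $x^1$ and $y^1$ of $G^1$ that are 1-wconnected but are not 1-wadjacent satisfy $d(x^1,y^1)\ge\omega$.
   Context: Let $G^0=\{X^0,B\}$ be a graph with 0-nodes $X^0$ and branches $B$. A 0-tip is an equivalence class of one-ended paths of $G^0$ under eventual identity. Partition the 0-tips into subsets and add to each at most one 0-node (no 0-node added twice); the resulting sets are the 1-nodes, $X^1$, and $G^1=\{X^0,B,X^1\}$. A 0-walk is a finite or infinite alternating sequence of 0-nodes and branches with each branch incident to its neighbouring 0-nodes, terminating at a 0-node where it terminates; a one-ended/endless 0-walk is extended if its tails are eventually one-ended paths, and then traverses their 0-tips. A 0-walk reaches a 1-node $x^1$ if it traverses a 0-tip in $x^1$ or terminates at a 0-node in $x^1$ (through a branch); it reaches 0-nodes at which it terminates. A two-ended 1-walk is $\langle x_0,W_0^0,x_1^1,\dots,x_{m-1}^1,W_{m-1}^0,x_m\rangle$ ($m\ge1$) with $x_1^1,\dots,x_{m-1}^1$ 1-nodes, each $W_k^0$ a nontrivial 0-walk reaching its two neighbouring nodes, and for $k=1,\dots,m-1$ at least one of $W_{k-1}^0,W_k^0$ reaching $x_k^1$ through a 0-tip. Two nodes are 1-wconnected if some 0-walk or 1-walk terminates at (reaches) both. A 0-section is the subgraph of $G^0$ induced by a maximal set of branches pairwise connected by paths in $G^0$; a 1-node is incident to a 0-section $S^0$ if it contains a 0-node incident to a branch of $S^0$ or a 0-tip with a representative path lying in $S^0$. Two 1-nodes are 1-wadjacent if they are incident to a common 0-section.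 Lengths: a finite 0-walk has length its number of branch traversals, an extended one-ended 0-walk $\omega$, an extended endless one $\omega\cdot2$; a two-ended 1-walk has length the natural sum of the lengths of its 0-walks. The wdistance $d(x,y)$ is the minimum length of a two-ended walk (finite 0-walk or two-ended 1-walk) terminating at $x$ and $y$. -}

module Defs where

open import Data.Nat using (ℕ; zero; suc; _+_; _≤_; _<_)
open import Data.Fin using (Fin; zero; suc; inject₁; fromℕ; toℕ)
open import Data.Product using (Σ; ∃; ∃₂; _×_; _,_; proj₁; proj₂)
open import Data.Sum using (_⊎_; inj₁; inj₂)
open import Data.Empty using (⊥)
open import Data.Unit using (⊤)
open import Relation.Binary.PropositionalEquality using (_≡_)

-- Ordinals below ω², in Cantor normal form ω·a + n.  All walk lengths
-- occurring here (n, ω, ω·2 and their natural sums) are of this form.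

record Ord : Set where
  constructor ω·_+_
  field
    ωcoeff : ℕ
    fin    : ℕ
open Ord public

_⊕_ : Ord → Ord → Ord
(ω· a + n) ⊕ (ω· b + k) = ω· (a + b) + (n + k)

_≤ₒ_ : Ord → Ord → Set
(ω· a + n) ≤ₒ (ω· b + k) = a < b ⊎ (a ≡ b × n ≤ k)

ω : Ord
ω = ω· 1 + 0

record Graph0 : Set₁ where
  field
    Node   : Set
    Branch : Set
    end₁ end₂ : Branch → Node

module _ (G : Graph0) where
  open Graph0 G

  Joins : Branch → Node → Node → Set
  Joins b u v = (end₁ b ≡ u × end₂ b ≡ v) ⊎ (end₁ b ≡ v × end₂ b ≡ u)

  record FinWalk : Set where
    field
      len  : ℕ
      node : Fin (suc len) → Node
      br   : Fin len → Branch
      adj  : ∀ i → Joins (br i) (node (inject₁ i)) (node (suc i))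

  start finish : FinWalk → Node
  start w = FinWalk.node w zero
  finish w = FinWalk.node w (fromℕ (FinWalk.len w))

  IsFinPath : FinWalk → Set
  IsFinPath w = ∀ i j → FinWalk.node w i ≡ FinWalk.node w j → i ≡ j

  record Ray : Set where
    field
      node : ℕ → Node
      br   : ℕ → Branch
      adj  : ∀ i → Joins (br i) (node i) (node (suc i))

  IsPath : Ray → Set
  IsPath r = ∀ i j → Ray.node r i ≡ Ray.node r j → i ≡ j

  Path : Set
  Path = Σ Ray IsPath

  Extended : Ray → Set
  Extended r = ∃ λ k → ∀ i j → Ray.node r (k + i) ≡ Ray.node r (k + j) → i ≡ j

  EventuallyIdentical : Ray → Ray → Set
  EventuallyIdentical r s = ∃₂ λ k m → ∀ i →
    Ray.node r (k + i) ≡ Ray.node s (m + i) × Ray.br r (k + i) ≡ Ray.br s (m + i)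

  EndOf : Branch → Node → Set
  EndOf b v = end₁ b ≡ v ⊎ end₂ b ≡ v

  BranchConnected : Branch → Branch → Set
  BranchConnected b c = Σ FinWalk λ w → IsFinPath w × EndOf b (start w) × EndOf c (finish w)

-- 1-graphs: the 0-tips are partitioned into nonempty blocks (tipNode sends
-- a one-ended path to the block containing its 0-tip; it is constant on
-- 0-tips and every block is nonempty), and each block receives at most one
-- 0-node, no 0-node being added twice.

record Graph1 (G : Graph0) : Set₁ where
  open Graph0 G
  field
    X1       : Set
    tipNode  : Path G → X1
    tipNode-resp : ∀ p q → EventuallyIdentical G (proj₁ p) (proj₁ q) → tipNode p ≡ tipNode q
    nonempty : ∀ x → ∃ λ p → tipNode p ≡ x
    _∈₀_     : Node → X1 → Set
    atMostOne : ∀ {u v x} → u ∈₀ x → v ∈₀ x → u ≡ v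
    notTwice  : ∀ {u x y} → u ∈₀ x → u ∈₀ y → x ≡ y

module _ {G : Graph0} (G1 : Graph1 G) where
  open Graph0 G
  open Graph1 G1

  AnyNode : Set
  AnyNode = Node ⊎ X1

  IsOneNode : AnyNode → Set
  IsOneNode (inj₁ _) = ⊥
  IsOneNode (inj₂ _) = ⊤

  TipIn : Ray G → X1 → Set
  TipIn r x = Σ (Path G) λ p → EventuallyIdentical G (proj₁ p) r × tipNode p ≡ x

  TermReach : Node → AnyNode → Set
  TermReach v (inj₁ u) = v ≡ u
  TermReach v (inj₂ x) = v ∈₀ x

  TipReach : Ray G → AnyNode → Set
  TipReach r (inj₁ _) = ⊥
  TipReach r (inj₂ x) = TipIn r x

  -- nontrivial 0-walks that can reach a node at each of their two "ends":
  --  finite nontrivial 0-walks, extended one-ended 0-walks (in either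
  --  orientation), and extended endless 0-walks (represented as two extended
  --  one-ended walks glued at their common initial 0-node: the endless walk
  --  is the reverse of the first followed by the second).
  data Seg : Set where
    finSeg  : (w : FinWalk G) → 1 ≤ FinWalk.len w → Seg
    rayOut  : (r : Ray G) → Extended G r → Seg
    rayIn   : (r : Ray G) → Extended G r → Seg
    endless : (r s : Ray G) → Extended G r → Extended G s →
              Ray.node r 0 ≡ Ray.node s 0 → Seg

  reachL reachR tipL tipR : Seg → AnyNode → Set
  reachL (finSeg w _) a = TermReach (start G w) a
  reachL (rayOut r _) a = TermReach (Ray.node r 0) a
  reachL (rayIn r _) a = TipReach r a
  reachL (endless r s _ _ _) a = TipReach r a
  reachR (finSeg w _) a = TermReach (finish G w) a
  reachR (rayOut r _) a = TipReach r a
  reachR (rayIn r _) a = TermReach (Ray.node r 0) a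
  reachR (endless r s _ _ _) a = TipReach s a
  tipL (finSeg w _) a = ⊥
  tipL (rayOut r _) a = ⊥
  tipL (rayIn r _) a = TipReach r a
  tipL (endless r s _ _ _) a = TipReach r a
  tipR (finSeg w _) a = ⊥
  tipR (rayOut r _) a = TipReach r a
  tipR (rayIn r _) a = ⊥
  tipR (endless r s _ _ _) a = TipReach s a

  segLen : Seg → Ord
  segLen (finSeg w _) = ω· 0 + FinWalk.len w
  segLen (rayOut _ _) = ω· 1 + 0
  segLen (rayIn _ _) = ω· 1 + 0
  segLen (endless _ _ _ _ _) = ω· 2 + 0

  sumLen : (m : ℕ) → (Fin m → Seg) → Ord
  sumLen zero f = ω· 0 + 0
  sumLen (suc m) f = segLen (f zero) ⊕ sumLen m (λ i → f (suc i))

  record Walk1 (a b : AnyNode) : Set where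
    field
      m     : ℕ
      m≥1   : 1 ≤ m
      nd    : Fin (suc m) → AnyNode
      seg   : Fin m → Seg
      first : nd zero ≡ a
      last  : nd (fromℕ m) ≡ b
      reaches : ∀ i → reachL (seg i) (nd (inject₁ i)) × reachR (seg i) (nd (suc i))
      internal : ∀ (i j : Fin m) → toℕ j ≡ suc (toℕ i) →
                 IsOneNode (nd (suc i)) × (tipR (seg i) (nd (suc i)) ⊎ tipL (seg j) (nd (suc i)))

  walk1Len : ∀ {a b} → Walk1 a b → Ord
  walk1Len w = sumLen (Walk1.m w) (Walk1.seg w)

  data TwoEnded (x y : X1) : Set where
    zeroW : (w : FinWalk G) → start G w ∈₀ x → finish G w ∈₀ y → TwoEnded x y
    oneW  : Walk1 (inj₂ x) (inj₂ y) → TwoEnded x y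

  twoEndedLen : ∀ {x y} → TwoEnded x y → Ord
  twoEndedLen (zeroW w _ _) = ω· 0 + FinWalk.len w
  twoEndedLen (oneW w) = walk1Len w

  WalkBetween : X1 → X1 → Set
  WalkBetween x y = TwoEnded x y ⊎ TwoEnded y x

  walkBetweenLen : ∀ {x y} → WalkBetween x y → Ord
  walkBetweenLen (inj₁ w) = twoEndedLen w
  walkBetweenLen (inj₂ w) = twoEndedLen w

  WConnected1 : X1 → X1 → Set
  WConnected1 x y =
      (Σ Seg λ s → (reachL s (inj₂ x) × reachR s (inj₂ y)) ⊎ (reachL s (inj₂ y) × reachR s (inj₂ x)))
    ⊎ (Walk1 (inj₂ x) (inj₂ y) ⊎ Walk1 (inj₂ y) (inj₂ x))

  -- 0-sections are represented by any of their branches b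
  -- (the section consists of all branches connected to b by paths)
  IncidentSection : X1 → Branch → Set
  IncidentSection x b =
      (Σ Branch λ c → BranchConnected G b c × (end₁ c ∈₀ x ⊎ end₂ c ∈₀ x))
    ⊎ (Σ (Path G) λ p → (∀ i → BranchConnected G b (Ray.br (proj₁ p) i)) × tipNode p ≡ x)

  WAdjacent1 : X1 → X1 → Set
  WAdjacent1 x y = Σ Branch λ b → IncidentSection x b × IncidentSection y b

{-# OPTIONS --safe #-}
module Submission where

-- A walk between two 1-nodes has finite length only if each of its 0-walks
-- is finite.  In a 1-walk with two or more 0-walks, the first interior 1-node
-- must be reached through a 0-tip, so some 0-walk is infinite; hence a walk of
-- finite length is a single finite 0-walk from a 0-node of x to a 0-node of y.
-- Such a walk contains a path, which puts its first and last branches in one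
-- 0-section, incident to both x and y.  A trivial walk forces x = y, and x is
-- incident to the 0-section of any path whose 0-tip lies in x.

open import Defs
open import Data.Nat using (zero; suc; _≤_; _<_; z≤n; s≤s)
open import Data.Nat.Properties using (≤-trans; m≤m+n; m≤n+m)
open import Data.Fin using (Fin; zero; suc; inject₁; fromℕ; toℕ)
open import Data.Fin.Properties using (suc-injective; toℕ-injective; toℕ-inject₁; toℕ-fromℕ)
open import Data.Vec.Functional using (_∷_)
open import Data.Product using (Σ; ∃; _×_; _,_; proj₁; proj₂)
open import Data.Sum using (inj₁; inj₂; [_,_]′)
open import Data.Empty using (⊥-elim)
open import Function using (_∘_)
open import Level using (0ℓ)
open import Effect.Monad using (RawMonad)
open import Relation.Nullary using (¬_; yes; no)
open import Relation.Nullary.Decidable using (¬¬-excluded-middle)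
open import Relation.Nullary.Negation using (¬¬-Monad)
open import Relation.Binary.PropositionalEquality using (_≡_; _≢_; refl; sym; cong; subst)

open RawMonad (¬¬-Monad {0ℓ}) using (pure; _>>=_)

ω≤ₒ-of-ωcoeff : ∀ {o} → 0 < ωcoeff o → ω ≤ₒ o
ω≤ₒ-of-ωcoeff {ω· suc zero + n} _ = inj₂ (refl , z≤n)
ω≤ₒ-of-ωcoeff {ω· suc (suc a) + n} _ = inj₁ (s≤s (s≤s z≤n))

module Paths (G : Graph0) where
  open Graph0 G
  open FinWalk

  PathBetween : Node → Node → Set
  PathBetween u v = Σ (FinWalk G) λ p → IsFinPath G p × start G p ≡ u × finish G p ≡ v

  trivialPath : ∀ u → PathBetween u u
  trivialPath u = record { len = 0 ; node = λ _ → u ; br = λ () ; adj = λ () }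
                , (λ { zero zero _ → refl }) , refl , refl

  suffixPath : (p : FinWalk G) → IsFinPath G p → (i : Fin (suc (len p))) →
               PathBetween (node p i) (finish G p)
  suffixPath p isP zero = p , isP , refl , refl
  suffixPath record { len = zero } isP (suc ())
  suffixPath record { len = suc n ; node = ν ; br = β ; adj = α } isP (suc i) =
    suffixPath (record { len = n ; node = ν ∘ suc ; br = β ∘ suc ; adj = α ∘ suc })
               (λ j k e → suc-injective (isP (suc j) (suc k) e)) i

  consPath : ∀ {b u} (p : FinWalk G) → IsFinPath G p → Joins G b u (start G p) →
             (∀ i → node p i ≢ u) → PathBetween u (finish G p)
  consPath {b} {u} p isP b-joins fresh = walk , distinct , refl , refl
    where
    adj′ : ∀ i → Joins G ((b ∷ br p) i) ((u ∷ node p) (inject₁ i)) ((u ∷ node p) (suc i))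
    adj′ zero = b-joins
    adj′ (suc i) = adj p i
    walk : FinWalk G
    walk = record { len = suc (len p) ; node = u ∷ node p ; br = b ∷ br p ; adj = adj′ }
    distinct : IsFinPath G walk
    distinct zero zero _ = refl
    distinct zero (suc k) e = ⊥-elim (fresh k (sym e))
    distinct (suc j) zero e = ⊥-elim (fresh j e)
    distinct (suc j) (suc k) e = cong suc (isP j k e)

  -- Without decidable equality of 0-nodes we cannot tell whether u already lies
  -- on p, so the case split only holds up to double negation.
  prependPath : ∀ {b u} (p : FinWalk G) → IsFinPath G p → Joins G b u (start G p) →
                ¬ ¬ PathBetween u (finish G p)
  prependPath {u = u} p isP b-joins = ¬¬-excluded-middle {A = ∃ λ i → node p i ≡ u} >>= λ where
    (yes (i , e)) → pure (subst (λ v → PathBetween v (finish G p)) e (suffixPath p isP i))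
    (no u∉p)      → pure (consPath p isP b-joins λ i e → u∉p (i , e))

  walk⇒path : (w : FinWalk G) → ¬ ¬ PathBetween (start G w) (finish G w)
  walk⇒path w = go (len w) (node w) (br w) (adj w)
    where
    go : ∀ n (ν : Fin (suc n) → Node) (β : Fin n → Branch) →
         (∀ i → Joins G (β i) (ν (inject₁ i)) (ν (suc i))) → ¬ ¬ PathBetween (ν zero) (ν (fromℕ n))
    go zero ν _ _ = pure (trivialPath (ν zero))
    go (suc n) ν β α = go n (ν ∘ suc) (β ∘ suc) (α ∘ suc) >>= λ (p , isP , s , f) →
      subst (¬_ ∘ ¬_ ∘ PathBetween (ν zero)) f
            (prependPath p isP (subst (Joins G (β zero) (ν zero)) (sym s) (α zero)))

  rayPrefixPath : (r : Path G) → ∀ i → PathBetween (Ray.node (proj₁ r) 0) (Ray.node (proj₁ r) i)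
  rayPrefixPath (r , isP) i =
    prefix , (λ j k e → toℕ-injective (isP _ _ e)) , refl , cong (Ray.node r) (toℕ-fromℕ i)
    where
    prefix : FinWalk G
    prefix = record
      { len = i ; node = Ray.node r ∘ toℕ ; br = Ray.br r ∘ toℕ
      ; adj = λ k → subst (λ n → Joins G (Ray.br r (toℕ k)) (Ray.node r n) (Ray.node r (suc (toℕ k))))
                          (sym (toℕ-inject₁ k)) (Ray.adj r (toℕ k)) }

  joins⇒EndOfˡ : ∀ {b u v} → Joins G b u v → EndOf G b u
  joins⇒EndOfˡ (inj₁ (e , _)) = inj₁ e
  joins⇒EndOfˡ (inj₂ (_ , e)) = inj₂ e

  joins⇒EndOfʳ : ∀ {b u v} → Joins G b u v → EndOf G b v
  joins⇒EndOfʳ (inj₁ (_ , e)) = inj₂ e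
  joins⇒EndOfʳ (inj₂ (e , _)) = inj₁ e

  path⇒BranchConnected : ∀ {b c u v} → PathBetween u v → EndOf G b u → EndOf G c v →
                         BranchConnected G b c
  path⇒BranchConnected (p , isP , refl , refl) b-at-u c-at-v = p , isP , b-at-u , c-at-v

  BranchConnected-refl : ∀ b → BranchConnected G b b
  BranchConnected-refl b = path⇒BranchConnected (trivialPath (end₁ b)) (inj₁ refl) (inj₁ refl)

  walk⇒BranchConnected : ∀ {b c} (w : FinWalk G) → EndOf G b (start G w) → EndOf G c (finish G w) →
                         ¬ ¬ BranchConnected G b c
  walk⇒BranchConnected w b-at-start c-at-finish =
    walk⇒path w >>= λ π → pure (path⇒BranchConnected π b-at-start c-at-finish)

  ray-BranchConnected : (r : Path G) → ∀ i → BranchConnected G (Ray.br (proj₁ r) 0) (Ray.br (proj₁ r) i)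
  ray-BranchConnected r i = path⇒BranchConnected (rayPrefixPath r i)
    (joins⇒EndOfˡ (Ray.adj (proj₁ r) 0)) (joins⇒EndOfˡ (Ray.adj (proj₁ r) i))

module _ {G : Graph0} (G1 : Graph1 G) where
  open Graph0 G
  open Graph1 G1
  open Paths G

  incident-via-end : ∀ {x b c v} → BranchConnected G b c → EndOf G c v → v ∈₀ x → IncidentSection G1 x b
  incident-via-end b~c (inj₁ e) v∈x = inj₁ (_ , b~c , inj₁ (subst (_∈₀ _) (sym e) v∈x))
  incident-via-end b~c (inj₂ e) v∈x = inj₁ (_ , b~c , inj₂ (subst (_∈₀ _) (sym e) v∈x))

  tip⇒IncidentSection : ∀ {x} (p : Path G) → tipNode p ≡ x → IncidentSection G1 x (Ray.br (proj₁ p) 0)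
  tip⇒IncidentSection p tip∈x = inj₂ (p , ray-BranchConnected p , tip∈x)

  WAdjacent1-refl : ∀ x → WAdjacent1 G1 x x
  WAdjacent1-refl x =
    let (p , tip∈x) = nonempty x in _ , tip⇒IncidentSection p tip∈x , tip⇒IncidentSection p tip∈x

  WAdjacent1-sym : ∀ {x y} → WAdjacent1 G1 x y → WAdjacent1 G1 y x
  WAdjacent1-sym (b , x-inc , y-inc) = b , y-inc , x-inc

  finWalk⇒WAdjacent1 : ∀ {x y} (w : FinWalk G) → start G w ∈₀ x → finish G w ∈₀ y →
                       ¬ ¬ WAdjacent1 G1 x y
  finWalk⇒WAdjacent1 {x} record { len = zero } s∈x f∈y =
    pure (subst (WAdjacent1 G1 x) (notTwice s∈x f∈y) (WAdjacent1-refl x))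
  finWalk⇒WAdjacent1 w@record { len = suc n ; br = β ; adj = α } s∈x f∈y =
    walk⇒BranchConnected w first-at-start last-at-finish >>= λ first~last →
    pure ( β zero
         , incident-via-end (BranchConnected-refl (β zero)) first-at-start s∈x
         , incident-via-end first~last last-at-finish f∈y )
    where
    first-at-start : EndOf G (β zero) (start G w)
    first-at-start = joins⇒EndOfˡ (α zero)
    last-at-finish : EndOf G (β (fromℕ n)) (finish G w)
    last-at-finish = joins⇒EndOfʳ (α (fromℕ n))

  Infinite : Seg G1 → Set
  Infinite s = 0 < ωcoeff (segLen G1 s)

  tipL⇒Infinite : ∀ s {a} → tipL G1 s a → Infinite s
  tipL⇒Infinite (finSeg _ _) ()
  tipL⇒Infinite (rayOut _ _) ()
  tipL⇒Infinite (rayIn _ _) _ = s≤s z≤n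
  tipL⇒Infinite (endless _ _ _ _ _) _ = s≤s z≤n

  tipR⇒Infinite : ∀ s {a} → tipR G1 s a → Infinite s
  tipR⇒Infinite (finSeg _ _) ()
  tipR⇒Infinite (rayOut _ _) _ = s≤s z≤n
  tipR⇒Infinite (rayIn _ _) ()
  tipR⇒Infinite (endless _ _ _ _ _) _ = s≤s z≤n

  reach-non-WAdjacent⇒Infinite : ∀ {x y} → ¬ WAdjacent1 G1 x y → (s : Seg G1) →
                                 reachL G1 s (inj₂ x) → reachR G1 s (inj₂ y) → Infinite s
  reach-non-WAdjacent⇒Infinite ¬adj (finSeg w _) s∈x f∈y = ⊥-elim (finWalk⇒WAdjacent1 w s∈x f∈y ¬adj)
  reach-non-WAdjacent⇒Infinite _ (rayOut _ _) _ _ = s≤s z≤n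
  reach-non-WAdjacent⇒Infinite _ (rayIn _ _) _ _ = s≤s z≤n
  reach-non-WAdjacent⇒Infinite _ (endless _ _ _ _ _) _ _ = s≤s z≤n

  ωcoeff-segLen≤sumLen : ∀ m (seg : Fin m → Seg G1) i → ωcoeff (segLen G1 (seg i)) ≤ ωcoeff (sumLen G1 m seg)
  ωcoeff-segLen≤sumLen (suc m) seg zero = m≤m+n _ _
  ωcoeff-segLen≤sumLen (suc m) seg (suc i) = ≤-trans (ωcoeff-segLen≤sumLen m (seg ∘ suc) i) (m≤n+m _ _)

  Infinite⇒ω≤sumLen : ∀ m (seg : Fin m → Seg G1) i → Infinite (seg i) → ω ≤ₒ sumLen G1 m seg
  Infinite⇒ω≤sumLen m seg i inf = ω≤ₒ-of-ωcoeff (≤-trans inf (ωcoeff-segLen≤sumLen m seg i))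

  ω≤walk1Len : ∀ {x y} → ¬ WAdjacent1 G1 x y → (w : Walk1 G1 (inj₂ x) (inj₂ y)) → ω ≤ₒ walk1Len G1 w
  ω≤walk1Len ¬adj record { m = zero ; m≥1 = () }
  ω≤walk1Len ¬adj record { m = suc zero ; seg = seg ; first = first ; last = last ; reaches = reaches } =
    Infinite⇒ω≤sumLen 1 seg zero (reach-non-WAdjacent⇒Infinite ¬adj (seg zero)
      (subst (reachL G1 (seg zero)) first (proj₁ (reaches zero)))
      (subst (reachR G1 (seg zero)) last (proj₂ (reaches zero))))
  ω≤walk1Len ¬adj record { m = suc (suc m) ; seg = seg ; internal = internal } =
    [ Infinite⇒ω≤sumLen _ seg zero ∘ tipR⇒Infinite (seg zero)
    , Infinite⇒ω≤sumLen _ seg (suc zero) ∘ tipL⇒Infinite (seg (suc zero))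
    ]′ (proj₂ (internal zero (suc zero) refl))

  ω≤twoEndedLen : ∀ {x y} → ¬ WAdjacent1 G1 x y → (w : TwoEnded G1 x y) → ω ≤ₒ twoEndedLen G1 w
  ω≤twoEndedLen ¬adj (zeroW w s∈x f∈y) = ⊥-elim (finWalk⇒WAdjacent1 w s∈x f∈y ¬adj)
  ω≤twoEndedLen ¬adj (oneW w) = ω≤walk1Len ¬adj w

-- 1-wconnectedness only guarantees that d(x, y) is defined; here the walk is given.
lemma10p2 : (G : Graph0) (G1 : Graph1 G) (x y : Graph1.X1 G1) →
    WConnected1 G1 x y → ¬ WAdjacent1 G1 x y →
    (w : WalkBetween G1 x y) → ω ≤ₒ walkBetweenLen G1 w
lemma10p2 G G1 x y _ ¬adj (inj₁ w) = ω≤twoEndedLen G1 ¬adj w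
lemma10p2 G G1 x y _ ¬adj (inj₂ w) = ω≤twoEndedLen G1 (¬adj ∘ WAdjacent1-sym G1) w
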